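{- For every integer $k\geq 3$, the firecracker graph $F_{2,k}$ satisfies $2\leq \chi_{lat}(F_{2,k})\leq 3$.
   Context: All graphs are finite, simple and connected. For a graph $G$ with $n$ vertices and $m$ edges, a bijection $g:V(G)\cup E(G)\to\{1,2,\dots,n+m\}$ is a local antimagic total labeling if $\omega_t(u)\neq\omega_t(v)$ for every edge $uv$, where $\omega_t(u)=g(u)+\sum_{e\in E(u)}g(e)$ and $E(u)$ is the set of edges incident with $u$. The local antimagic total chromatic number $\chi_{lat}(G)$ is the minimum number of distinct values of $\omega_t$ over all local antimagic total labelings of $G$. The firecracker graph $F_{n,k}$ has vertex set $\{u_i:1\le i\le n\}\cup\{v_{i,j}:1\le i\le n,1\le j\le k\}$ and edge set $\{v_{i,1}v_{i+1,1}:1\le i\le n-1\}\cup\{u_iv_{i,j}:1\le i\le n,1\le j\le k\}$. -}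

module Defs where

open import Data.Nat using (ℕ; zero; suc; _+_; _*_; _≤_)
open import Data.Nat.Properties using (_≟_)
open import Data.Fin using (Fin; toℕ; _↑ˡ_; _↑ʳ_; inject₁; combine)
import Data.Fin as F
open import Data.Fin.Properties using () renaming (_≟_ to _≟F_)
open import Data.Sum using (_⊎_; inj₁; inj₂)
open import Data.Product using (_×_; _,_; proj₁; proj₂; Σ; ∃)
open import Data.List using (List; length; map; deduplicate; allFin)
open import Data.Bool using (_∨_; if_then_else_)
open import Relation.Nullary using (¬_; does)
open import Relation.Binary.PropositionalEquality using (_≡_)
open import Function.Bundles using (_⤖_; Bijection)

record Graph : Set where
  field
    order : ℕ
    size  : ℕ
    ends  : Fin size → Fin order × Fin order
open Graph public

sumFin : ∀ {m} → (Fin m → ℕ) → ℕ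
sumFin {zero}  f = 0
sumFin {suc m} f = f F.zero + sumFin (λ i → f (F.suc i))

-- a total labeling: bijection V ∪ E → {1,…,n+m}  (label x = 1 + toℕ (g x))
TotalLabeling : Graph → Set
TotalLabeling G = (Fin (order G) ⊎ Fin (size G)) ⤖ Fin (order G + size G)

label : (G : Graph) → TotalLabeling G → Fin (order G) ⊎ Fin (size G) → ℕ
label G g x = suc (toℕ (Bijection.to g x))

incident : (G : Graph) → Fin (size G) → Fin (order G) → Data.Bool.Bool
incident G e u = does (proj₁ (ends G e) ≟F u) ∨ does (proj₂ (ends G e) ≟F u)

weight : (G : Graph) → TotalLabeling G → Fin (order G) → ℕ
weight G g u = label G g (inj₁ u)
  + sumFin (λ e → if incident G e u then label G g (inj₂ e) else 0)

IsLocalAntimagicTotal : (G : Graph) → TotalLabeling G → Set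
IsLocalAntimagicTotal G g =
  ∀ e → ¬ (weight G g (proj₁ (ends G e)) ≡ weight G g (proj₂ (ends G e)))

numColours : (G : Graph) → TotalLabeling G → ℕ
numColours G g = length (deduplicate _≟_ (map (weight G g) (allFin (order G))))

IsChiLat : Graph → ℕ → Set
IsChiLat G c =
  (Σ (TotalLabeling G) λ g → IsLocalAntimagicTotal G g × numColours G g ≡ c)
  × (∀ (g : TotalLabeling G) → IsLocalAntimagicTotal G g → c ≤ numColours G g)

-- Vertices: u_i ↦ i ↑ˡ (n*k),  v_{i,j} ↦ n ↑ʳ combine i j
-- (indices 0-based, so v_{i,1} of the paper is v i 0).
-- Edges: path edges v_{i,1}v_{i+1,1} (i < n-1) ↦ first n-1 indices,
-- spokes u_i v_{i,j} ↦ next n*k indices.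
firecracker : ℕ → ℕ → Graph
firecracker zero k = record { order = 0 ; size = 0 ; ends = λ () }
firecracker (suc n) zero =
  record { order = suc n ; size = 0 ; ends = λ () }
firecracker (suc n) (suc k) = record
  { order = suc n + suc n * suc k
  ; size  = n + suc n * suc k
  ; ends  = ends'
  }
  where
  uv : Fin (suc n) → Fin (suc n + suc n * suc k)
  uv i = i ↑ˡ (suc n * suc k)
  vv : Fin (suc n) → Fin (suc k) → Fin (suc n + suc n * suc k)
  vv i j = suc n ↑ʳ combine i j
  ends' : Fin (n + suc n * suc k) → Fin (suc n + suc n * suc k) × Fin (suc n + suc n * suc k)
  ends' e with F.splitAt n e
  ... | inj₁ i = vv (inject₁ i) F.zero , vv (F.suc i) F.zero
  ... | inj₂ p with F.remQuot {suc n} (suc k) p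
  ...   | (i , j) = uv i , vv i j

module Submission where

-- For k = 3 an explicit labeling of F₂,₃ with the two weights 19 and 20 exists, and any
-- edge already forces two weights.
--
-- For k ≥ 4 two weights are impossible.  If u₁ has weight a and v₁,₁ has weight b ≠ a,
-- then every leaf of u₁ has weight b, the path edge forces w(v₂,₁) = a, hence w(u₂) = b
-- and every leaf of u₂ has weight a.  Adding up the weights of all 2k leaves gives
-- k (a + b) + L(u₁) + L(u₂) = (sum of all labels) + L(v₁,₁v₂,₁), while
-- a + b = L(u₁) + L(u₂) + (sum of spoke labels) is a sum of 2k + 2 distinct labels.
-- Therefore k (1 + ⋯ + (2k + 2)) ≤ (1 + ⋯ + (4k + 3)) + (4k + 3), which fails for k ≥ 4.
--
-- Three weights suffice for every k ≥ 3.  The leaves v_{i,j} with j ≥ 2 take the largest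
-- labels and their spokes the smallest ones, in complementary order, so that all these
-- leaves get the same weight.  The spokes to v₁,ⱼ₊₁ and v₂,ⱼ₊₁ get the labels 2j and 2j + 1
-- in alternating order, which balances the two hub weights up to the parity of k; the few
-- remaining labels in the middle absorb that parity.

open import Defs
open import Data.Nat using (ℕ; _≤_)
open import Data.Product using (Σ; _×_)

open import Data.Bool using (_∨_; if_then_else_)
open import Data.Empty using (⊥-elim)
open import Data.Fin using (Fin; zero; suc; toℕ; #_; lower₁; punchIn; punchOut; opposite; cast; splitAt)
open import Data.Fin using (_↑ˡ_; _↑ʳ_; combine; remQuot)
open import Data.Fin.Patterns using (0F; 1F; 2F; 3F)
import Data.Fin.Properties as Fin
open import Data.Fin.Permutation using (Permutation; _⟨$⟩ʳ_)
open import Data.List using (List; []; _∷_; length; map; deduplicate; allFin)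
open import Data.List.Properties using (length-removeAt′)
open import Data.List.Membership.Propositional using (_∈_)
open import Data.List.Membership.Propositional.Properties
  using (∈-map⁺; ∈-map⁻; ∈-allFin; ∈-deduplicate⁺; ∈-deduplicate⁻)
open import Data.List.Relation.Binary.Subset.Propositional using (_⊆_)
import Data.List.Relation.Unary.All as All
open import Data.List.Relation.Unary.All using ([]; _∷_)
open import Data.List.Relation.Unary.AllPairs using ([]; _∷_)
open import Data.List.Relation.Unary.Any using (here; there; index; _─_)
open import Data.List.Relation.Unary.Unique.Propositional using (Unique)
open import Data.List.Relation.Unary.Unique.DecPropositional.Properties using (deduplicate-!)
open import Data.Nat using (zero; suc; _+_; _*_; _<_; z≤n; s≤s; s≤s⁻¹)
import Data.Nat.Properties as ℕ
open import Data.Nat.Properties using (module ≤-Reasoning)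
open import Data.Nat.Tactic.RingSolver using (solve-∀)
open import Algebra.Properties.CommutativeMonoid.Sum ℕ.+-0-commutativeMonoid using (sum; ∑-distrib-+; sum-remove; sum-permute)
open import Algebra.Properties.CommutativeSemigroup ℕ.*-commutativeSemigroup using (x∙yz≈y∙xz)
open import Data.Product using (_,_; proj₁; proj₂; uncurry)
open import Data.Sum using (_⊎_; inj₁; inj₂; [_,_]′)
import Data.Sum.Properties as Sum
open import Data.Unit using (tt)
open import Data.Vec using (Vec; []; _∷_; lookup)
open import Function using (_∘_)
open import Function.Bundles using (Bijection; Injection; _⤖_; mk⤖)
open import Function.Consequences.Propositional using (strictlySurjective⇒surjective)
open import Function.Definitions using (Injective; StrictlySurjective)
open import Function.Properties.Bijection using (⤖⇒↔)
open import Function.Properties.Inverse using (↔-trans; ↔⇒↣)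
open import Relation.Nullary using (¬?; does; yes; no; contradiction)
open import Relation.Nullary.Decidable using (dec-true; dec-false; toWitness)
open import Relation.Binary.PropositionalEquality
  using (_≡_; _≢_; _≗_; refl; sym; trans; subst; cong; cong₂; module ≡-Reasoning)

-- Counting distinct weights

module _ {A : Set} where

  ∈-─⁺ : ∀ {x y : A} {ys} (x∈ys : x ∈ ys) → y ∈ ys → x ≢ y → y ∈ (ys ─ x∈ys)
  ∈-─⁺ (here refl)  (here refl)  x≢y = ⊥-elim (x≢y refl)
  ∈-─⁺ (here refl)  (there y∈ys) _   = y∈ys
  ∈-─⁺ (there _)    (here refl)  _   = here refl
  ∈-─⁺ (there x∈ys) (there y∈ys) x≢y = there (∈-─⁺ x∈ys y∈ys x≢y)

  unique⊆⇒length≤ : ∀ {xs ys : List A} → Unique xs → xs ⊆ ys → length xs ≤ length ys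
  unique⊆⇒length≤ {[]}     _            _     = z≤n
  unique⊆⇒length≤ {x ∷ xs} {ys} (x∉xs ∷ xs!) xs⊆ys = ℕ.≤-trans
    (s≤s (unique⊆⇒length≤ xs! λ y∈xs → ∈-─⁺ x∈ys (xs⊆ys (there y∈xs)) (All.lookup x∉xs y∈xs)))
    (ℕ.≤-reflexive (sym (length-removeAt′ ys (index x∈ys))))
    where x∈ys = xs⊆ys (here refl)

module _ (G : Graph) (g : TotalLabeling G) where

  private
    w = weight G g

  weights colours : List ℕ
  weights = map w (allFin (order G))
  colours = deduplicate ℕ._≟_ weights

  weight∈colours : ∀ x → w x ∈ colours
  weight∈colours x = ∈-deduplicate⁺ ℕ._≟_ (∈-map⁺ w (∈-allFin x))

  numColours≤ : ∀ {cs} → (∀ x → w x ∈ cs) → numColours G g ≤ length cs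
  numColours≤ {cs} w∈cs = unique⊆⇒length≤ (deduplicate-! ℕ._≟_ weights) λ c∈colours →
    let x , _ , c≡wx = ∈-map⁻ w (∈-deduplicate⁻ ℕ._≟_ weights c∈colours)
    in  subst (_∈ cs) (sym c≡wx) (w∈cs x)

  numColours≥2 : ∀ {x y} → w x ≢ w y → 2 ≤ numColours G g
  numColours≥2 {x} {y} x≢y = unique⊆⇒length≤ ((x≢y ∷ []) ∷ [] ∷ [])
    λ { (here refl) → weight∈colours x ; (there (here refl)) → weight∈colours y }

  numColours≥3 : ∀ {x y z} → w x ≢ w y → w x ≢ w z → w y ≢ w z → 3 ≤ numColours G g
  numColours≥3 {x} {y} {z} x≢y x≢z y≢z = unique⊆⇒length≤ ((x≢y ∷ x≢z ∷ []) ∷ (y≢z ∷ []) ∷ [] ∷ [])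
    λ { (here refl)                 → weight∈colours x
      ; (there (here refl))         → weight∈colours y
      ; (there (there (here refl))) → weight∈colours z
      }

  numColours≤2⇒weight≡⊎≡ : numColours G g ≤ 2 → ∀ {x y} → w x ≢ w y → ∀ z → w z ≡ w x ⊎ w z ≡ w y
  numColours≤2⇒weight≡⊎≡ ≤2 {x} {y} x≢y z with w z ℕ.≟ w x | w z ℕ.≟ w y
  ... | yes z≡x | _       = inj₁ z≡x
  ... | no _    | yes z≡y = inj₂ z≡y
  ... | no z≢x  | no z≢y  = ⊥-elim (ℕ.<⇒≱ (numColours≥3 x≢y (z≢x ∘ sym) (z≢y ∘ sym)) ≤2)

-- Finite sums

sumFin≡sum : ∀ {m} (f : Fin m → ℕ) → sumFin f ≡ sum f
sumFin≡sum {zero}  f = refl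
sumFin≡sum {suc m} f = cong (f zero +_) (sumFin≡sum (f ∘ suc))

sumFin-cong : ∀ {m} {f g : Fin m → ℕ} → f ≗ g → sumFin f ≡ sumFin g
sumFin-cong {zero}  f≗g = refl
sumFin-cong {suc m} f≗g = cong₂ _+_ (f≗g zero) (sumFin-cong (f≗g ∘ suc))

sumFin-const : ∀ m c → sumFin {m} (λ _ → c) ≡ m * c
sumFin-const zero    c = refl
sumFin-const (suc m) c = cong (c +_) (sumFin-const m c)

sumFin-zero : ∀ m → sumFin {m} (λ _ → 0) ≡ 0
sumFin-zero m = trans (sumFin-const m 0) (ℕ.*-zeroʳ m)

sumFin-+ : ∀ {m} (f g : Fin m → ℕ) → sumFin (λ i → f i + g i) ≡ sumFin f + sumFin g
sumFin-+ f g = begin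
  sumFin (λ i → f i + g i) ≡⟨ sumFin≡sum (λ i → f i + g i) ⟩
  sum (λ i → f i + g i)    ≡⟨ ∑-distrib-+ f g ⟩
  sum f + sum g            ≡⟨ cong₂ _+_ (sumFin≡sum f) (sumFin≡sum g) ⟨
  sumFin f + sumFin g      ∎
  where open ≡-Reasoning

sumFin-punchIn : ∀ {m} (f : Fin (suc m) → ℕ) i → sumFin f ≡ f i + sumFin (f ∘ punchIn i)
sumFin-punchIn f i = begin
  sumFin f                     ≡⟨ sumFin≡sum f ⟩
  sum f                        ≡⟨ sum-remove f ⟩
  f i + sum (f ∘ punchIn i)    ≡⟨ cong (f i +_) (sumFin≡sum (f ∘ punchIn i)) ⟨
  f i + sumFin (f ∘ punchIn i) ∎
  where open ≡-Reasoning

sumFin-indicator : ∀ {m} (f : Fin m → ℕ) i → sumFin (λ j → if does (j Fin.≟ i) then f j else 0) ≡ f i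
sumFin-indicator {suc m} f zero    = trans (cong (f zero +_) (sumFin-zero m)) (ℕ.+-identityʳ (f zero))
sumFin-indicator {suc m} f (suc i) = sumFin-indicator (f ∘ suc) i

sumFin-splitAt : ∀ m {n} (f : Fin (m + n) → ℕ) →
                 sumFin f ≡ sumFin (λ i → f (i ↑ˡ n)) + sumFin (λ j → f (m ↑ʳ j))
sumFin-splitAt zero    f = refl
sumFin-splitAt (suc m) f = trans (cong (f zero +_) (sumFin-splitAt m (f ∘ suc))) (sym (ℕ.+-assoc (f zero) _ _))

sumFin-combine : ∀ m n (f : Fin (m * n) → ℕ) → sumFin f ≡ sumFin {m} (λ i → sumFin {n} (λ j → f (combine i j)))
sumFin-combine zero    n f = refl
sumFin-combine (suc m) n f =
  trans (sumFin-splitAt n f) (cong (sumFin {n} (λ j → f (j ↑ˡ (m * n))) +_) (sumFin-combine m n (f ∘ (n ↑ʳ_))))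

tri : ℕ → ℕ
tri n = sumFin {n} (λ i → suc (toℕ i))

tri-suc : ∀ n → tri (suc n) ≡ suc n + tri n
tri-suc n = cong suc (begin
  sumFin {n} (λ i → 1 + suc (toℕ i)) ≡⟨ sumFin-+ {n} (λ _ → 1) (λ i → suc (toℕ i)) ⟩
  sumFin {n} (λ _ → 1) + tri n       ≡⟨ cong (_+ tri n) (trans (sumFin-const n 1) (ℕ.*-identityʳ n)) ⟩
  n + tri n                          ∎)
  where open ≡-Reasoning

2*tri[n]≡n*[1+n] : ∀ n → 2 * tri n ≡ n * suc n
2*tri[n]≡n*[1+n] zero    = refl
2*tri[n]≡n*[1+n] (suc n) = begin
  2 * tri (suc n)        ≡⟨ cong (2 *_) (tri-suc n) ⟩
  2 * (suc n + tri n)    ≡⟨ ℕ.*-distribˡ-+ 2 (suc n) (tri n) ⟩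
  2 * suc n + 2 * tri n  ≡⟨ cong (2 * suc n +_) (2*tri[n]≡n*[1+n] n) ⟩
  2 * suc n + n * suc n  ≡⟨ ℕ.*-distribʳ-+ (suc n) 2 n ⟨
  (2 + n) * suc n        ≡⟨ ℕ.*-comm (2 + n) (suc n) ⟩
  suc n * (2 + n)        ∎
  where open ≡-Reasoning

private
  tri≤sumFin-belowTop : ∀ n {m} (f : Fin m → Fin (suc n)) → Injective _≡_ _≡_ f → (∀ i → n ≢ toℕ (f i)) →
    (∀ {m} (h : Fin m → Fin n) → Injective _≡_ _≡_ h → tri m ≤ sumFin (λ i → suc (toℕ (h i)))) →
    tri m ≤ sumFin (λ i → suc (toℕ (f i)))
  tri≤sumFin-belowTop n {m} f f-inj n≢f bound = begin
    tri m                           ≤⟨ bound f′ (f-inj ∘ Fin.lower₁-injective) ⟩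
    sumFin (λ i → suc (toℕ (f′ i))) ≡⟨ sumFin-cong (λ i → cong suc (Fin.toℕ-lower₁ (f i) (n≢f i))) ⟩
    sumFin (λ i → suc (toℕ (f i)))  ∎
    where
    open ≤-Reasoning
    f′ = λ i → lower₁ (f i) (n≢f i)

tri≤sumFin-injective : ∀ n {m} (f : Fin m → Fin n) → Injective _≡_ _≡_ f →
                       tri m ≤ sumFin (λ i → suc (toℕ (f i)))
tri≤sumFin-injective n       {zero}  f f-inj = z≤n
tri≤sumFin-injective zero    {suc m} f f-inj = ⊥-elim (Fin.¬Fin0 (f zero))
tri≤sumFin-injective (suc n) {suc m} f f-inj with Fin.any? (λ i → n ℕ.≟ toℕ (f i))
... | no ∄i = tri≤sumFin-belowTop n f f-inj (λ i n≡fi → ∄i (i , n≡fi)) (tri≤sumFin-injective n)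
... | yes (i₀ , n≡fi₀) = begin
  tri (suc m)                     ≡⟨ tri-suc m ⟩
  suc m + tri m                   ≤⟨ ℕ.+-mono-≤ (Fin.injective⇒≤ f-inj) rest ⟩
  suc n + Σf′                     ≡⟨ cong (λ t → suc t + Σf′) n≡fi₀ ⟩
  suc (toℕ (f i₀)) + Σf′          ≡⟨ sumFin-punchIn (λ i → suc (toℕ (f i))) i₀ ⟨
  sumFin (λ i → suc (toℕ (f i)))  ∎
  where
  open ≤-Reasoning
  f′ = f ∘ punchIn i₀
  Σf′ = sumFin (λ j → suc (toℕ (f′ j)))
  rest : tri m ≤ Σf′
  rest = tri≤sumFin-belowTop n f′ (Fin.punchIn-injective i₀ _ _ ∘ f-inj)
           (λ j n≡f′j → Fin.punchInᵢ≢i i₀ j (f-inj (Fin.toℕ-injective (trans (sym n≡f′j) n≡fi₀))))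
           (tri≤sumFin-injective n)

sumFin-permutation≡tri : ∀ {n} (π : Permutation n n) → sumFin (λ i → suc (toℕ (π ⟨$⟩ʳ i))) ≡ tri n
sumFin-permutation≡tri {n} π = begin
  sumFin (λ i → suc (toℕ (π ⟨$⟩ʳ i))) ≡⟨ sumFin≡sum (λ i → suc (toℕ (π ⟨$⟩ʳ i))) ⟩
  sum (λ i → suc (toℕ (π ⟨$⟩ʳ i)))    ≡⟨ sum-permute (λ i → suc (toℕ i)) π ⟨
  sum {n} (λ i → suc (toℕ i))         ≡⟨ sumFin≡sum {n} (λ i → suc (toℕ i)) ⟨
  tri n                               ∎
  where open ≡-Reasoning

sumFin-labels≡tri : (G : Graph) (g : TotalLabeling G) →
  sumFin (λ x → label G g (inj₁ x)) + sumFin (λ e → label G g (inj₂ e)) ≡ tri (order G + size G)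
sumFin-labels≡tri G g = begin
  sumFin (λ x → label G g (inj₁ x)) + sumFin (λ e → label G g (inj₂ e))
    ≡⟨ cong₂ _+_ (sumFin-cong (λ x → cong (label G g) (Fin.splitAt-↑ˡ (order G) x (size G))))
                 (sumFin-cong (λ e → cong (label G g) (Fin.splitAt-↑ʳ (order G) (size G) e))) ⟨
  sumFin (λ i → suc (toℕ (π ⟨$⟩ʳ (i ↑ˡ size G)))) + sumFin (λ i → suc (toℕ (π ⟨$⟩ʳ (order G ↑ʳ i))))
    ≡⟨ sumFin-splitAt (order G) (λ i → suc (toℕ (π ⟨$⟩ʳ i))) ⟨
  sumFin (λ i → suc (toℕ (π ⟨$⟩ʳ i)))
    ≡⟨ sumFin-permutation≡tri π ⟩
  tri (order G + size G) ∎
  where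
  open ≡-Reasoning
  π : Permutation (order G + size G) (order G + size G)
  π = ↔-trans Fin.+↔⊎ (⤖⇒↔ g)

injective⇒strictlySurjective : ∀ {n} (f : Fin n → Fin n) → Injective _≡_ _≡_ f → StrictlySurjective _≡_ f
injective⇒strictlySurjective {suc n} f f-inj y with Fin.any? (λ x → f x Fin.≟ y)
... | yes y∈f = y∈f
... | no  y∉f = ⊥-elim (ℕ.1+n≰n (Fin.injective⇒≤ punchOut∘f-inj))
  where
  y≢f : ∀ x → y ≢ f x
  y≢f x y≡fx = y∉f (x , sym y≡fx)
  punchOut∘f-inj : Injective _≡_ _≡_ (λ x → punchOut (y≢f x))
  punchOut∘f-inj = f-inj ∘ Fin.punchOut-injective (y≢f _) (y≢f _)

leftInverse⇒bijection : ∀ {m n} (to : Fin m ⊎ Fin n → Fin (m + n)) (from : Fin (m + n) → Fin m ⊎ Fin n) →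
                        (∀ x → from (to x) ≡ x) → (Fin m ⊎ Fin n) ⤖ Fin (m + n)
leftInverse⇒bijection {m} {n} to from from∘to = mk⤖ (to-inj , strictlySurjective⇒surjective to-surj)
  where
  to-inj : Injective _≡_ _≡_ to
  to-inj {x} {y} eq = trans (sym (from∘to x)) (trans (cong from eq) (from∘to y))
  splitAt-inj : Injective _≡_ _≡_ (splitAt m {n})
  splitAt-inj = Injection.injective (↔⇒↣ Fin.+↔⊎)
  to-surj : StrictlySurjective _≡_ to
  to-surj y = let x , eq = injective⇒strictlySurjective (to ∘ splitAt m) (splitAt-inj ∘ to-inj) y in splitAt m x , eq

-- Firecracker k concerns F₂,ₖ₊₁: hub u i has the k + 1 leaves v i j, of which v i 0F lies on the path.
module Firecracker (k : ℕ) where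

  K : ℕ
  K = suc k

  F : Graph
  F = firecracker 2 K

  Element : Set
  Element = Fin (order F) ⊎ Fin (size F)

  u : Fin 2 → Fin (order F)
  u i = i ↑ˡ (2 * K)

  v : Fin 2 → Fin K → Fin (order F)
  v i j = 2 ↑ʳ combine i j

  pathEdge : Fin (size F)
  pathEdge = zero

  spoke : Fin 2 → Fin K → Fin (size F)
  spoke i j = suc (combine i j)

  ends-spoke : ∀ i j → ends F (spoke i j) ≡ (u i , v i j)
  ends-spoke 0F j rewrite Fin.splitAt-↑ˡ K j (K + 0) = refl
  ends-spoke 1F j rewrite Fin.splitAt-↑ʳ K (K + 0) (j ↑ˡ 0) | Fin.splitAt-↑ˡ K j 0 = refl

  v-injective : ∀ i j i′ j′ → v i j ≡ v i′ j′ → i ≡ i′ × j ≡ j′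
  v-injective i j i′ j′ = Fin.combine-injective i j i′ j′ ∘ Fin.↑ʳ-injective 2 _ _

  incident-path : ∀ i j → incident F pathEdge (v i j) ≡ does (j Fin.≟ 0F)
  incident-path 0F 0F      = refl
  incident-path 1F 0F      = dec-true (v 1F 0F Fin.≟ v 1F 0F) refl
  incident-path 0F (suc j) =
    dec-false (v 1F 0F Fin.≟ v 0F (suc j)) (λ eq → contradiction (proj₁ (v-injective 1F 0F 0F (suc j) eq)) λ ())
  incident-path 1F (suc j) =
    dec-false (v 1F 0F Fin.≟ v 1F (suc j)) (λ eq → contradiction (proj₂ (v-injective 1F 0F 1F (suc j) eq)) λ ())

  vertex-elim : ∀ {ℓ} (P : Fin (order F) → Set ℓ) → (∀ i → P (u i)) → (∀ i j → P (v i j)) → ∀ x → P x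
  vertex-elim P Pu Pv 0F            = Pu 0F
  vertex-elim P Pu Pv 1F            = Pu 1F
  vertex-elim P Pu Pv (suc (suc c)) =
    subst (λ c → P (suc (suc c))) (Fin.combine-remQuot {2} K c) (Pv (proj₁ (remQuot {2} K c)) (proj₂ (remQuot {2} K c)))

  edge-elim : ∀ {ℓ} (P : Fin (size F) → Set ℓ) → P pathEdge → (∀ i j → P (spoke i j)) → ∀ e → P e
  edge-elim P Pp Ps zero    = Pp
  edge-elim P Pp Ps (suc c) =
    subst (λ c → P (suc c)) (Fin.combine-remQuot {2} K c) (Ps (proj₁ (remQuot {2} K c)) (proj₂ (remQuot {2} K c)))

  module Weights (g : TotalLabeling F) where

    L : Element → ℕ
    L = label F g

    w : Fin (order F) → ℕ
    w = weight F g

    incidentLabel : Fin (order F) → Fin (size F) → ℕ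
    incidentLabel x e = if incident F e x then L (inj₂ e) else 0

    pathLabelAt : Fin K → ℕ
    pathLabelAt j = if does (j Fin.≟ 0F) then L (inj₂ pathEdge) else 0

    incidentSpokeLabels : Fin (order F) → ℕ
    incidentSpokeLabels x = sumFin {2} (λ i → sumFin {K} (λ j → incidentLabel x (spoke i j)))

    weight≡incidentLabels : ∀ x → w x ≡ L (inj₁ x) + (incidentLabel x pathEdge + incidentSpokeLabels x)
    weight≡incidentLabels x =
      cong (λ s → L (inj₁ x) + (incidentLabel x pathEdge + s)) (sumFin-combine 2 K (λ c → incidentLabel x (suc c)))

    incidentLabel-spoke : ∀ i j x → incidentLabel x (spoke i j) ≡
                          (if does (u i Fin.≟ x) ∨ does (v i j Fin.≟ x) then L (inj₂ (spoke i j)) else 0)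
    incidentLabel-spoke i j x =
      cong (λ (y , z) → if does (y Fin.≟ x) ∨ does (z Fin.≟ x) then L (inj₂ (spoke i j)) else 0) (ends-spoke i j)

    weight-u : ∀ i → w (u i) ≡ L (inj₁ (u i)) + sumFin (λ j → L (inj₂ (spoke i j)))
    weight-u i = trans (weight≡incidentLabels (u i)) (cong (L (inj₁ (u i)) +_) (spokes i))
      where
      spokes : ∀ i → incidentLabel (u i) pathEdge + incidentSpokeLabels (u i) ≡ sumFin (λ j → L (inj₂ (spoke i j)))
      spokes 0F = trans (cong₂ (λ s t → s + (t + 0))
                          (sumFin-cong (λ j → incidentLabel-spoke 0F j (u 0F)))
                          (trans (sumFin-cong (λ j → incidentLabel-spoke 1F j (u 0F))) (sumFin-zero K)))
                        (ℕ.+-identityʳ _)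
      spokes 1F = trans (cong₂ (λ s t → s + (t + 0))
                          (trans (sumFin-cong (λ j → incidentLabel-spoke 0F j (u 1F))) (sumFin-zero K))
                          (sumFin-cong (λ j → incidentLabel-spoke 1F j (u 1F))))
                        (ℕ.+-identityʳ _)

    incidentLabel-v-spoke : ∀ i j i′ j′ → incidentLabel (v i j) (spoke i′ j′) ≡
                            (if does (combine i′ j′ Fin.≟ combine i j) then L (inj₂ (suc (combine i′ j′))) else 0)
    incidentLabel-v-spoke i j 0F j′ = incidentLabel-spoke 0F j′ (v i j)
    incidentLabel-v-spoke i j 1F j′ = incidentLabel-spoke 1F j′ (v i j)

    weight-v : ∀ i j → w (v i j) ≡ L (inj₁ (v i j)) + (pathLabelAt j + L (inj₂ (spoke i j)))
    weight-v i j = begin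
      w (v i j)
        ≡⟨ weight≡incidentLabels (v i j) ⟩
      L (inj₁ (v i j)) + (incidentLabel (v i j) pathEdge + incidentSpokeLabels (v i j))
        ≡⟨ cong₂ (λ s t → L (inj₁ (v i j)) + (s + t))
                 (cong (λ b → if b then L (inj₂ pathEdge) else 0) (incident-path i j))
                 (trans (sumFin-cong (sumFin-cong ∘ incidentLabel-v-spoke i j)) (sym (sumFin-combine 2 K atSpoke))) ⟩
      L (inj₁ (v i j)) + (pathLabelAt j + sumFin atSpoke)
        ≡⟨ cong (λ s → L (inj₁ (v i j)) + (pathLabelAt j + s))
                (sumFin-indicator (λ c → L (inj₂ (suc c))) (combine i j)) ⟩
      L (inj₁ (v i j)) + (pathLabelAt j + L (inj₂ (spoke i j))) ∎
      where
      open ≡-Reasoning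
      atSpoke : Fin (2 * K) → ℕ
      atSpoke c = if does (c Fin.≟ combine i j) then L (inj₂ (suc c)) else 0

    Σv Σs : Fin 2 → ℕ
    Σv i = sumFin (λ j → L (inj₁ (v i j)))
    Σs i = sumFin (λ j → L (inj₂ (spoke i j)))

    sumFin-vertexLabels : sumFin (λ x → L (inj₁ x)) ≡ L (inj₁ (u 0F)) + (L (inj₁ (u 1F)) + (Σv 0F + (Σv 1F + 0)))
    sumFin-vertexLabels =
      cong (λ s → L (inj₁ (u 0F)) + (L (inj₁ (u 1F)) + s)) (sumFin-combine 2 K (λ c → L (inj₁ (suc (suc c)))))

    sumFin-edgeLabels : sumFin (λ e → L (inj₂ e)) ≡ L (inj₂ pathEdge) + (Σs 0F + (Σs 1F + 0))
    sumFin-edgeLabels = cong (L (inj₂ pathEdge) +_) (sumFin-combine 2 K (λ c → L (inj₂ (suc c))))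

    sumFin-weight-v : ∀ i → sumFin (λ j → w (v i j)) ≡ Σv i + (L (inj₂ pathEdge) + Σs i)
    sumFin-weight-v i = begin
      sumFin (λ j → w (v i j))
        ≡⟨ sumFin-cong (weight-v i) ⟩
      sumFin (λ j → L (inj₁ (v i j)) + (pathLabelAt j + L (inj₂ (spoke i j))))
        ≡⟨ sumFin-+ (λ j → L (inj₁ (v i j))) (λ j → pathLabelAt j + L (inj₂ (spoke i j))) ⟩
      Σv i + sumFin (λ j → pathLabelAt j + L (inj₂ (spoke i j)))
        ≡⟨ cong (Σv i +_) (sumFin-+ pathLabelAt (λ j → L (inj₂ (spoke i j)))) ⟩
      Σv i + (sumFin pathLabelAt + Σs i)
        ≡⟨ cong (λ s → Σv i + (s + Σs i)) (sumFin-indicator {K} (λ _ → L (inj₂ pathEdge)) 0F) ⟩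
      Σv i + (L (inj₂ pathEdge) + Σs i) ∎
      where open ≡-Reasoning

    hubsAndSpokes : Fin (2 + 2 * K) → Element
    hubsAndSpokes 0F            = inj₁ (u 0F)
    hubsAndSpokes 1F            = inj₁ (u 1F)
    hubsAndSpokes (suc (suc c)) = inj₂ (suc c)

    hubsAndSpokes-injective : Injective _≡_ _≡_ hubsAndSpokes
    hubsAndSpokes-injective {0F}          {0F}           _    = refl
    hubsAndSpokes-injective {1F}          {1F}           _    = refl
    hubsAndSpokes-injective {suc (suc c)} {suc (suc .c)} refl = refl
    hubsAndSpokes-injective {0F}          {1F}           ()
    hubsAndSpokes-injective {0F}          {suc (suc _)}  ()
    hubsAndSpokes-injective {1F}          {0F}           ()
    hubsAndSpokes-injective {1F}          {suc (suc _)}  ()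
    hubsAndSpokes-injective {suc (suc _)} {0F}           ()
    hubsAndSpokes-injective {suc (suc _)} {1F}           ()

    tri≤hubAndSpokeLabels : tri (2 + 2 * K) ≤ L (inj₁ (u 0F)) + (L (inj₁ (u 1F)) + (Σs 0F + (Σs 1F + 0)))
    tri≤hubAndSpokeLabels = begin
      tri (2 + 2 * K)
        ≤⟨ tri≤sumFin-injective _ (Bijection.to g ∘ hubsAndSpokes) (hubsAndSpokes-injective ∘ Bijection.injective g) ⟩
      sumFin (L ∘ hubsAndSpokes)
        ≡⟨ cong (λ s → L (inj₁ (u 0F)) + (L (inj₁ (u 1F)) + s)) (sumFin-combine 2 K (λ c → L (inj₂ (suc c)))) ⟩
      L (inj₁ (u 0F)) + (L (inj₁ (u 1F)) + (Σs 0F + (Σs 1F + 0))) ∎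
      where open ≤-Reasoning

  module TwoColouring (g : TotalLabeling F) (antimagic : IsLocalAntimagicTotal F g) (≤2 : numColours F g ≤ 2) where

    open Weights g

    antimagic-spoke : ∀ i j → w (u i) ≢ w (v i j)
    antimagic-spoke i j = antimagic (spoke i j) ∘ subst (λ (x , y) → w x ≡ w y) (sym (ends-spoke i j))

    a b : ℕ
    a = w (u 0F)
    b = w (v 0F 0F)

    coloured : ∀ x → w x ≡ a ⊎ w x ≡ b
    coloured = numColours≤2⇒weight≡⊎≡ F g ≤2 (antimagic-spoke 0F 0F)

    ≢a⇒≡b : ∀ {x} → w x ≢ a → w x ≡ b
    ≢a⇒≡b {x} x≢a = [ ⊥-elim ∘ x≢a , (λ x≡b → x≡b) ]′ (coloured x)

    ≢b⇒≡a : ∀ {x} → w x ≢ b → w x ≡ a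
    ≢b⇒≡a {x} x≢b = [ (λ x≡a → x≡a) , ⊥-elim ∘ x≢b ]′ (coloured x)

    w-v₀ : ∀ j → w (v 0F j) ≡ b
    w-v₀ j = ≢a⇒≡b (antimagic-spoke 0F j ∘ sym)

    w-v₁₀ : w (v 1F 0F) ≡ a
    w-v₁₀ = ≢b⇒≡a (antimagic pathEdge ∘ sym)

    w-u₁ : w (u 1F) ≡ b
    w-u₁ = ≢a⇒≡b (λ u₁≡a → antimagic-spoke 1F 0F (trans u₁≡a (sym w-v₁₀)))

    w-v₁ : ∀ j → w (v 1F j) ≡ a
    w-v₁ j = ≢b⇒≡a (λ v₁ⱼ≡b → antimagic-spoke 1F j (trans w-u₁ (sym v₁ⱼ≡b)))

    -- Each label is counted once by the leaves' weights, except those of the hubs (never)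
    -- and of the path edge (twice).
    sumFin-leafWeights : K * (a + b) + (L (inj₁ (u 0F)) + L (inj₁ (u 1F))) ≡
                         sumFin (λ x → L (inj₁ x)) + sumFin (λ e → L (inj₂ e)) + L (inj₂ pathEdge)
    sumFin-leafWeights = begin
      K * (a + b) + (Lu₀ + Lu₁)
        ≡⟨ cong (_+ (Lu₀ + Lu₁)) (ℕ.*-distribˡ-+ K a b) ⟩
      K * a + K * b + (Lu₀ + Lu₁)
        ≡⟨ cong₂ (λ s t → s + t + (Lu₀ + Lu₁)) (side 1F a w-v₁) (side 0F b w-v₀) ⟨
      (Σv 1F + (Lp + Σs 1F)) + (Σv 0F + (Lp + Σs 0F)) + (Lu₀ + Lu₁)
        ≡⟨ regroup (Σv 0F) (Σv 1F) (Σs 0F) (Σs 1F) Lp Lu₀ Lu₁ ⟩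
      (Lu₀ + (Lu₁ + (Σv 0F + (Σv 1F + 0)))) + (Lp + (Σs 0F + (Σs 1F + 0))) + Lp
        ≡⟨ cong₂ (λ s t → s + t + Lp) sumFin-vertexLabels sumFin-edgeLabels ⟨
      sumFin (λ x → L (inj₁ x)) + sumFin (λ e → L (inj₂ e)) + Lp ∎
      where
      open ≡-Reasoning
      Lu₀ = L (inj₁ (u 0F))
      Lu₁ = L (inj₁ (u 1F))
      Lp  = L (inj₂ pathEdge)
      side : ∀ i c → (∀ j → w (v i j) ≡ c) → Σv i + (Lp + Σs i) ≡ K * c
      side i c w≡c = trans (sym (sumFin-weight-v i)) (trans (sumFin-cong w≡c) (sumFin-const K c))
      regroup : ∀ v₀ v₁ s₀ s₁ p u₀ u₁ → (v₁ + (p + s₁)) + (v₀ + (p + s₀)) + (u₀ + u₁) ≡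
                                        (u₀ + (u₁ + (v₀ + (v₁ + 0)))) + (p + (s₀ + (s₁ + 0))) + p
      regroup = solve-∀

    K*tri≤tri+N : K * tri (2 + 2 * K) ≤ tri (order F + size F) + (order F + size F)
    K*tri≤tri+N = begin
      K * tri (2 + 2 * K)
        ≤⟨ ℕ.*-monoʳ-≤ K (ℕ.≤-trans tri≤hubAndSpokeLabels (ℕ.≤-reflexive hubAndSpokeLabels≡a+b)) ⟩
      K * (a + b)
        ≤⟨ ℕ.m≤m+n (K * (a + b)) _ ⟩
      K * (a + b) + (L (inj₁ (u 0F)) + L (inj₁ (u 1F)))
        ≡⟨ sumFin-leafWeights ⟩
      sumFin (λ x → L (inj₁ x)) + sumFin (λ e → L (inj₂ e)) + L (inj₂ pathEdge)
        ≡⟨ cong (_+ L (inj₂ pathEdge)) (sumFin-labels≡tri F g) ⟩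
      tri (order F + size F) + L (inj₂ pathEdge)
        ≤⟨ ℕ.+-monoʳ-≤ (tri (order F + size F)) (Fin.toℕ<n (Bijection.to g (inj₂ pathEdge))) ⟩
      tri (order F + size F) + (order F + size F) ∎
      where
      open ≤-Reasoning
      regroup : ∀ u₀ u₁ s₀ s₁ → u₀ + (u₁ + (s₀ + (s₁ + 0))) ≡ (u₀ + s₀) + (u₁ + s₁)
      regroup = solve-∀
      hubAndSpokeLabels≡a+b : L (inj₁ (u 0F)) + (L (inj₁ (u 1F)) + (Σs 0F + (Σs 1F + 0))) ≡ a + b
      hubAndSpokeLabels≡a+b = trans (regroup (L (inj₁ (u 0F))) (L (inj₁ (u 1F))) (Σs 0F) (Σs 1F))
                                    (cong₂ _+_ (sym (weight-u 0F)) (trans (sym (weight-u 1F)) w-u₁))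

tri-gap : ∀ r → let K = 4 + r; N = (2 + 2 * K) + (1 + 2 * K) in tri N + N < K * tri (2 + 2 * K)
tri-gap r = ℕ.*-cancelˡ-< 2 _ _ (begin-strict
  2 * (tri N + N)                             ≡⟨ ℕ.*-distribˡ-+ 2 (tri N) N ⟩
  2 * tri N + 2 * N                           ≡⟨ cong (_+ 2 * N) (2*tri[n]≡n*[1+n] N) ⟩
  N * suc N + 2 * N                           <⟨ ℕ.m<m+n (N * suc N + 2 * N) (s≤s z≤n) ⟩
  N * suc N + 2 * N + suc _                   ≡⟨ expand r ⟩
  K * (M * suc M)                             ≡⟨ cong (K *_) (2*tri[n]≡n*[1+n] M) ⟨
  K * (2 * tri M)                             ≡⟨ x∙yz≈y∙xz K 2 (tri M) ⟩
  2 * (K * tri M)                             ∎)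
  where
  open ≤-Reasoning
  K = 4 + r
  M = 2 + 2 * K
  N = (2 + 2 * K) + (1 + 2 * K)
  expand : ∀ r → let K = 4 + r; M = 2 + 2 * K; N = (2 + 2 * K) + (1 + 2 * K) in
           N * suc N + 2 * N + suc (4 * (r * r * r) + 42 * (r * r) + 114 * r + 21) ≡ K * (M * suc M)
  expand = solve-∀

localAntimagic⇒3≤numColours : ∀ r → let open Firecracker (3 + r) in
  (g : TotalLabeling F) → IsLocalAntimagicTotal F g → 3 ≤ numColours F g
localAntimagic⇒3≤numColours r g antimagic =
  ℕ.≮⇒≥ λ n<3 → ℕ.<⇒≱ (tri-gap r) (Firecracker.TwoColouring.K*tri≤tri+N (3 + r) g antimagic (s≤s⁻¹ n<3))

-- Three weights for k ≥ 3

alternate : Fin 2 → ℕ → Fin 2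
alternate i zero    = i
alternate i (suc n) = alternate (opposite i) n

alternate-opposite : ∀ i n → alternate (opposite i) n ≡ opposite (alternate i n)
alternate-opposite i zero    = refl
alternate-opposite i (suc n) = alternate-opposite (opposite i) n

alternate-involutive : ∀ i n → alternate (alternate i n) n ≡ i
alternate-involutive i zero    = refl
alternate-involutive i (suc n) = begin
  alternate (opposite (alternate (opposite i) n)) n ≡⟨ alternate-opposite (alternate (opposite i) n) n ⟩
  opposite (alternate (alternate (opposite i) n) n) ≡⟨ cong opposite (alternate-involutive (opposite i) n) ⟩
  opposite (opposite i)                             ≡⟨ Fin.opposite-involutive i ⟩
  i                                                 ∎
  where open ≡-Reasoning

opposite≢ : ∀ (i : Fin 2) → opposite i ≢ i
opposite≢ 0F ()
opposite≢ 1F ()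

toℕ+toℕ-opposite : ∀ (i : Fin 2) → toℕ i + toℕ (opposite i) ≡ 1
toℕ+toℕ-opposite 0F = refl
toℕ+toℕ-opposite 1F = refl

toℕ-opposite+suc-toℕ : ∀ {n} (i : Fin n) → toℕ (opposite i) + suc (toℕ i) ≡ n
toℕ-opposite+suc-toℕ i = trans (cong (_+ suc (toℕ i)) (Fin.opposite-prop i)) (ℕ.m∸n+n≡m (Fin.toℕ<n i))

sumAlternate : Fin 2 → ℕ → ℕ
sumAlternate i n = sumFin {n} (λ j → toℕ (alternate i (toℕ j)))

sumAlternate-1 : ∀ n → sumAlternate 1F n ≡ sumAlternate 0F n + toℕ (alternate 0F n)
sumAlternate-1 zero    = refl
sumAlternate-1 (suc n) = begin
  suc (sumAlternate 0F n)                            ≡⟨ ℕ.+-comm 1 (sumAlternate 0F n) ⟩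
  sumAlternate 0F n + 1                              ≡⟨ cong (sumAlternate 0F n +_) (toℕ+toℕ-opposite a) ⟨
  sumAlternate 0F n + (toℕ a + toℕ (opposite a))     ≡⟨ ℕ.+-assoc (sumAlternate 0F n) (toℕ a) (toℕ (opposite a)) ⟨
  sumAlternate 0F n + toℕ a + toℕ (opposite a)
    ≡⟨ cong₂ _+_ (sumAlternate-1 n) (cong toℕ (alternate-opposite 0F n)) ⟨
  sumAlternate 1F n + toℕ (alternate 1F n)           ∎
  where
  open ≡-Reasoning
  a = alternate 0F n

-- Label l is encoded by the index l − 1 ∈ Fin M, M = 4k + 7.  In order: the path edge, the
-- spokes of the pendant leaves v i (suc j), six core elements, the pendant leaves in reverse
-- order.  The pendant v i (suc j) gets s = 2j + alternate i j, hence spoke label 2 + s and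
-- leaf label 4k + 7 − s; p orders the last two core labels according to the parity of k.
module ThreeColouring (r : ℕ) where

  k : ℕ
  k = 2 + r

  open Firecracker k

  p : Fin 2
  p = alternate 1F k

  pendant : Fin 2 → Fin k → Fin (k * 2)
  pendant i j = combine j (alternate i (toℕ j))

  baseSpokeSum : ℕ
  baseSpokeSum = sumFin {k} (λ j → 2 + 2 * toℕ j)

  M : ℕ
  M = 1 + (k * 2 + (6 + k * 2))

  pendantSpokeIndex pendantLeafIndex : Fin (k * 2) → Fin M
  pendantSpokeIndex s = suc (s ↑ˡ (6 + k * 2))
  pendantLeafIndex  s = suc (k * 2 ↑ʳ (6 ↑ʳ opposite s))

  coreIndex : Fin 6 → Fin M
  coreIndex c = suc (k * 2 ↑ʳ (c ↑ˡ k * 2))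

  vIndex spokeIndex : Fin 2 → Fin K → Fin M
  vIndex i  (suc j) = pendantLeafIndex (pendant i j)
  vIndex 0F 0F      = coreIndex 1F
  vIndex 1F 0F      = coreIndex (4 ↑ʳ opposite p)
  spokeIndex i  (suc j) = pendantSpokeIndex (pendant i j)
  spokeIndex 0F 0F      = coreIndex 3F
  spokeIndex 1F 0F      = coreIndex (4 ↑ʳ p)

  labelIndex : Element → Fin M
  labelIndex (inj₁ 0F)            = coreIndex 2F
  labelIndex (inj₁ 1F)            = coreIndex 0F
  labelIndex (inj₁ (suc (suc c))) = uncurry vIndex (remQuot K c)
  labelIndex (inj₂ zero)          = zero
  labelIndex (inj₂ (suc c))       = uncurry spokeIndex (remQuot K c)

  spokeAt leafAt : Fin k × Fin 2 → Element
  spokeAt (j , ρ) = inj₂ (spoke (alternate ρ (toℕ j)) (suc j))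
  leafAt  (j , ρ) = inj₁ (v (alternate ρ (toℕ j)) (suc j))

  coreAt : Fin 6 → Element
  coreAt 0F                        = inj₁ (u 1F)
  coreAt 1F                        = inj₁ (v 0F 0F)
  coreAt 2F                        = inj₁ (u 0F)
  coreAt 3F                        = inj₂ (spoke 0F 0F)
  coreAt (suc (suc (suc (suc t)))) = if does (t Fin.≟ p) then inj₂ (spoke 1F 0F) else inj₁ (v 1F 0F)

  position : Fin M → Element
  position zero    = inj₂ pathEdge
  position (suc y) =
    [ spokeAt ∘ remQuot 2 , [ coreAt , leafAt ∘ remQuot 2 ∘ opposite ]′ ∘ splitAt 6 ]′ (splitAt (k * 2) y)

  position-pendantSpokeIndex : ∀ s → position (pendantSpokeIndex s) ≡ spokeAt (remQuot 2 s)
  position-pendantSpokeIndex s rewrite Fin.splitAt-↑ˡ (k * 2) s (6 + k * 2) = refl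

  position-coreIndex : ∀ c → position (coreIndex c) ≡ coreAt c
  position-coreIndex c rewrite Fin.splitAt-↑ʳ (k * 2) (6 + k * 2) (c ↑ˡ k * 2) | Fin.splitAt-↑ˡ 6 c (k * 2) = refl

  position-pendantLeafIndex : ∀ s → position (pendantLeafIndex s) ≡ leafAt (remQuot 2 s)
  position-pendantLeafIndex s
    rewrite Fin.splitAt-↑ʳ (k * 2) (6 + k * 2) (6 ↑ʳ opposite s) | Fin.splitAt-↑ʳ 6 (k * 2) (opposite s)
          | Fin.opposite-involutive s = refl

  remQuot-pendant : ∀ i j → remQuot 2 (pendant i j) ≡ (j , alternate i (toℕ j))
  remQuot-pendant i j = Fin.remQuot-combine j (alternate i (toℕ j))

  position-vIndex : ∀ i j → position (vIndex i j) ≡ inj₁ (v i j)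
  position-vIndex 0F 0F      = position-coreIndex 1F
  position-vIndex 1F 0F      = trans (position-coreIndex (4 ↑ʳ opposite p))
    (cong (λ b → if b then inj₂ (spoke 1F 0F) else inj₁ (v 1F 0F)) (dec-false (opposite p Fin.≟ p) (opposite≢ p)))
  position-vIndex i  (suc j) = trans (position-pendantLeafIndex (pendant i j))
    (trans (cong leafAt (remQuot-pendant i j))
           (cong (λ i′ → inj₁ (v i′ (suc j))) (alternate-involutive i (toℕ j))))

  position-spokeIndex : ∀ i j → position (spokeIndex i j) ≡ inj₂ (spoke i j)
  position-spokeIndex 0F 0F      = position-coreIndex 3F
  position-spokeIndex 1F 0F      = trans (position-coreIndex (4 ↑ʳ p))
    (cong (λ b → if b then inj₂ (spoke 1F 0F) else inj₁ (v 1F 0F)) (dec-true (p Fin.≟ p) refl))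
  position-spokeIndex i  (suc j) = trans (position-pendantSpokeIndex (pendant i j))
    (trans (cong spokeAt (remQuot-pendant i j))
           (cong (λ i′ → inj₂ (spoke i′ (suc j))) (alternate-involutive i (toℕ j))))

  labelIndex-v : ∀ i j → labelIndex (inj₁ (v i j)) ≡ vIndex i j
  labelIndex-v i j = cong (uncurry vIndex) (Fin.remQuot-combine i j)

  labelIndex-spoke : ∀ i j → labelIndex (inj₂ (spoke i j)) ≡ spokeIndex i j
  labelIndex-spoke i j = cong (uncurry spokeIndex) (Fin.remQuot-combine i j)

  position-labelIndex : ∀ x → position (labelIndex x) ≡ x
  position-labelIndex (inj₁ x) = vertex-elim (λ x → position (labelIndex (inj₁ x)) ≡ inj₁ x)
    (λ { 0F → position-coreIndex 2F ; 1F → position-coreIndex 0F })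
    (λ i j → trans (cong position (labelIndex-v i j)) (position-vIndex i j)) x
  position-labelIndex (inj₂ e) = edge-elim (λ e → position (labelIndex (inj₂ e)) ≡ inj₂ e) refl
    (λ i j → trans (cong position (labelIndex-spoke i j)) (position-spokeIndex i j)) e

  M≡order+size : M ≡ order F + size F
  M≡order+size = count r
    where
    count : ∀ r → 1 + ((2 + r) * 2 + (6 + (2 + r) * 2)) ≡ (2 + 2 * (3 + r)) + (1 + 2 * (3 + r))
    count = solve-∀

  labeling : TotalLabeling F
  labeling = leftInverse⇒bijection (cast M≡order+size ∘ labelIndex) (position ∘ cast (sym M≡order+size))
    λ x → trans (cong position (Fin.cast-involutive (sym M≡order+size) M≡order+size (labelIndex x)))
                (position-labelIndex x)

  open Weights labeling

  L≡ : ∀ x {y} → labelIndex x ≡ y → L x ≡ suc (toℕ y)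
  L≡ x refl = cong suc (Fin.toℕ-cast M≡order+size (labelIndex x))

  toℕ-coreIndex : ∀ c → toℕ (coreIndex c) ≡ suc (k * 2 + toℕ c)
  toℕ-coreIndex c = cong suc (trans (Fin.toℕ-↑ʳ (k * 2) (c ↑ˡ k * 2)) (cong (k * 2 +_) (Fin.toℕ-↑ˡ c (k * 2))))

  toℕ-pendantSpokeIndex : ∀ s → toℕ (pendantSpokeIndex s) ≡ suc (toℕ s)
  toℕ-pendantSpokeIndex s = cong suc (Fin.toℕ-↑ˡ s (6 + k * 2))

  toℕ-pendantLeafIndex : ∀ s → toℕ (pendantLeafIndex s) ≡ suc (k * 2 + (6 + toℕ (opposite s)))
  toℕ-pendantLeafIndex s =
    cong suc (trans (Fin.toℕ-↑ʳ (k * 2) (6 ↑ʳ opposite s)) (cong (k * 2 +_) (Fin.toℕ-↑ʳ 6 (opposite s))))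

  L-core : ∀ x c → labelIndex x ≡ coreIndex c → L x ≡ 2 + (k * 2 + toℕ c)
  L-core x c eq = trans (L≡ x eq) (cong suc (toℕ-coreIndex c))

  L-pendantSpoke : ∀ i j → L (inj₂ (spoke i (suc j))) ≡ 2 + toℕ (pendant i j)
  L-pendantSpoke i j =
    trans (L≡ (inj₂ (spoke i (suc j))) (labelIndex-spoke i (suc j))) (cong suc (toℕ-pendantSpokeIndex (pendant i j)))

  L-pendantLeaf : ∀ i j → L (inj₁ (v i (suc j))) ≡ 2 + (k * 2 + (6 + toℕ (opposite (pendant i j))))
  L-pendantLeaf i j =
    trans (L≡ (inj₁ (v i (suc j))) (labelIndex-v i (suc j))) (cong suc (toℕ-pendantLeafIndex (pendant i j)))

  C D E : ℕ
  C = 9 + 4 * k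
  D = 9 + 4 * k + (baseSpokeSum + sumAlternate 0F k)
  E = 14 + 4 * k

  w-pendant : ∀ i j → w (v i (suc j)) ≡ C
  w-pendant i j = begin
    w (v i (suc j))                                      ≡⟨ weight-v i (suc j) ⟩
    L (inj₁ (v i (suc j))) + L (inj₂ (spoke i (suc j)))  ≡⟨ cong₂ _+_ (L-pendantLeaf i j) (L-pendantSpoke i j) ⟩
    2 + (k * 2 + (6 + toℕ (opposite s))) + (2 + toℕ s)   ≡⟨ regroup k (toℕ (opposite s)) (toℕ s) ⟩
    9 + k * 2 + (toℕ (opposite s) + suc (toℕ s))         ≡⟨ cong (9 + k * 2 +_) (toℕ-opposite+suc-toℕ s) ⟩
    9 + k * 2 + k * 2                                    ≡⟨ double k ⟩
    C                                                    ∎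
    where
    open ≡-Reasoning
    s = pendant i j
    regroup : ∀ k o t → 2 + (k * 2 + (6 + o)) + (2 + t) ≡ 9 + k * 2 + (o + suc t)
    regroup = solve-∀
    double : ∀ k → 9 + k * 2 + k * 2 ≡ 9 + 4 * k
    double = solve-∀

  w-v₀₀ : w (v 0F 0F) ≡ C
  w-v₀₀ = begin
    w (v 0F 0F)
      ≡⟨ weight-v 0F 0F ⟩
    L (inj₁ (v 0F 0F)) + (L (inj₂ pathEdge) + L (inj₂ (spoke 0F 0F)))
      ≡⟨ cong₂ (λ s t → s + (1 + t)) (L-core (inj₁ (v 0F 0F)) 1F (labelIndex-v 0F 0F))
                                     (L-core (inj₂ (spoke 0F 0F)) 3F (labelIndex-spoke 0F 0F)) ⟩
    2 + (k * 2 + 1) + (1 + (2 + (k * 2 + 3)))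
      ≡⟨ collect k ⟩
    C ∎
    where
    open ≡-Reasoning
    collect : ∀ k → 2 + (k * 2 + 1) + (1 + (2 + (k * 2 + 3))) ≡ 9 + 4 * k
    collect = solve-∀

  w-v₁₀ : w (v 1F 0F) ≡ E
  w-v₁₀ = begin
    w (v 1F 0F)
      ≡⟨ weight-v 1F 0F ⟩
    L (inj₁ (v 1F 0F)) + (L (inj₂ pathEdge) + L (inj₂ (spoke 1F 0F)))
      ≡⟨ cong₂ (λ s t → s + (1 + t)) (L-core (inj₁ (v 1F 0F)) (4 ↑ʳ opposite p) (labelIndex-v 1F 0F))
                                     (L-core (inj₂ (spoke 1F 0F)) (4 ↑ʳ p) (labelIndex-spoke 1F 0F)) ⟩
    2 + (k * 2 + (4 + toℕ (opposite p))) + (1 + (2 + (k * 2 + (4 + toℕ p))))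
      ≡⟨ collect k (toℕ p) (toℕ (opposite p)) ⟩
    13 + 4 * k + (toℕ p + toℕ (opposite p))
      ≡⟨ cong (13 + 4 * k +_) (toℕ+toℕ-opposite p) ⟩
    13 + 4 * k + 1
      ≡⟨ ℕ.+-comm (13 + 4 * k) 1 ⟩
    E ∎
    where
    open ≡-Reasoning
    collect : ∀ k a b → 2 + (k * 2 + (4 + b)) + (1 + (2 + (k * 2 + (4 + a)))) ≡ 13 + 4 * k + (a + b)
    collect = solve-∀

  sumFin-pendantSpokes : ∀ i → sumFin {k} (λ j → L (inj₂ (spoke i (suc j)))) ≡ baseSpokeSum + sumAlternate i k
  sumFin-pendantSpokes i = trans
    (sumFin-cong λ j → trans (L-pendantSpoke i j) (cong (2 +_) (Fin.toℕ-combine j (alternate i (toℕ j)))))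
    (sumFin-+ {k} (λ j → 2 + 2 * toℕ j) (λ j → toℕ (alternate i (toℕ j))))

  w-u : ∀ i → w (u i) ≡ D
  w-u 0F = begin
    w (u 0F)
      ≡⟨ weight-u 0F ⟩
    L (inj₁ (u 0F)) + (L (inj₂ (spoke 0F 0F)) + sumFin {k} (λ j → L (inj₂ (spoke 0F (suc j)))))
      ≡⟨ cong₂ _+_ (L-core (inj₁ (u 0F)) 2F refl)
                   (cong₂ _+_ (L-core (inj₂ (spoke 0F 0F)) 3F (labelIndex-spoke 0F 0F)) (sumFin-pendantSpokes 0F)) ⟩
    2 + (k * 2 + 2) + (2 + (k * 2 + 3) + (baseSpokeSum + sumAlternate 0F k))
      ≡⟨ collect k baseSpokeSum (sumAlternate 0F k) ⟩
    D ∎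
    where
    open ≡-Reasoning
    collect : ∀ k x a → 2 + (k * 2 + 2) + (2 + (k * 2 + 3) + (x + a)) ≡ 9 + 4 * k + (x + a)
    collect = solve-∀
  w-u 1F = begin
    w (u 1F)
      ≡⟨ weight-u 1F ⟩
    L (inj₁ (u 1F)) + (L (inj₂ (spoke 1F 0F)) + sumFin {k} (λ j → L (inj₂ (spoke 1F (suc j)))))
      ≡⟨ cong₂ _+_ (L-core (inj₁ (u 1F)) 0F refl)
                   (cong₂ _+_ (L-core (inj₂ (spoke 1F 0F)) (4 ↑ʳ p) (labelIndex-spoke 1F 0F))
                              (trans (sumFin-pendantSpokes 1F) (cong (baseSpokeSum +_) (sumAlternate-1 k)))) ⟩
    2 + (k * 2 + 0) + (2 + (k * 2 + (4 + toℕ p)) + (baseSpokeSum + (sumAlternate 0F k + toℕ a)))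
      ≡⟨ collect k baseSpokeSum (sumAlternate 0F k) (toℕ a) (toℕ p) ⟩
    8 + 4 * k + S + (toℕ a + toℕ p)
      ≡⟨ cong (8 + 4 * k + S +_) a+p≡1 ⟩
    8 + 4 * k + S + 1
      ≡⟨ ℕ.+-comm (8 + 4 * k + S) 1 ⟩
    D ∎
    where
    open ≡-Reasoning
    a = alternate 0F k
    S = baseSpokeSum + sumAlternate 0F k
    a+p≡1 : toℕ a + toℕ p ≡ 1
    a+p≡1 = trans (cong (λ q → toℕ a + toℕ q) (alternate-opposite 0F k)) (toℕ+toℕ-opposite a)
    collect : ∀ k x s b q → 2 + (k * 2 + 0) + (2 + (k * 2 + (4 + q)) + (x + (s + b))) ≡ 8 + 4 * k + (x + s) + (b + q)
    collect = solve-∀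

  C<E : C < E
  C<E = ℕ.+-monoˡ-≤ (4 * k) (ℕ.m≤m+n 10 4)

  E<D : E < D
  E<D = subst (_≤ D) (ℕ.+-comm (9 + 4 * k) 6)
    (ℕ.+-monoʳ-≤ (9 + 4 * k) (ℕ.≤-trans (ℕ.m≤m+n 6 _) (ℕ.m≤m+n baseSpokeSum (sumAlternate 0F k))))

  w-v : ∀ i j → w (v i j) ≡ C ⊎ w (v i j) ≡ E
  w-v 0F 0F      = inj₁ w-v₀₀
  w-v 1F 0F      = inj₂ w-v₁₀
  w-v i  (suc j) = inj₁ (w-pendant i j)

  u≢v : ∀ i j → w (u i) ≢ w (v i j)
  u≢v i j u≡v = [ (λ v≡C → ℕ.<⇒≢ (ℕ.<-trans C<E E<D) (trans (sym v≡C) (trans (sym u≡v) (w-u i))))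
                , (λ v≡E → ℕ.<⇒≢ E<D (trans (sym v≡E) (trans (sym u≡v) (w-u i)))) ]′ (w-v i j)

  antimagic : IsLocalAntimagicTotal F labeling
  antimagic = edge-elim (λ e → w (proj₁ (ends F e)) ≢ w (proj₂ (ends F e)))
    (λ v₀₀≡v₁₀ → ℕ.<⇒≢ C<E (trans (sym w-v₀₀) (trans v₀₀≡v₁₀ w-v₁₀)))
    (λ i j → subst (λ (x , y) → w x ≢ w y) (sym (ends-spoke i j)) (u≢v i j))

  numColours≡3 : numColours F labeling ≡ 3
  numColours≡3 = ℕ.≤-antisym
    (numColours≤ F labeling (vertex-elim (λ x → w x ∈ C ∷ D ∷ E ∷ [])
      (λ i → there (here (w-u i)))
      (λ i j → [ here , there ∘ there ∘ here ]′ (w-v i j))))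
    (numColours≥3 F labeling {v 0F 0F} {u 0F} {v 1F 0F}
      (λ C≡D → ℕ.<⇒≢ (ℕ.<-trans C<E E<D) (trans (sym w-v₀₀) (trans C≡D (w-u 0F))))
      (λ C≡E → ℕ.<⇒≢ C<E (trans (sym w-v₀₀) (trans C≡E w-v₁₀)))
      (λ D≡E → ℕ.<⇒≢ E<D (sym (trans (sym (w-u 0F)) (trans D≡E w-v₁₀)))))

-- Two weights for k = 3

-- Labels: u₁ 1, u₂ 8, v₁,ⱼ 12 13 11, v₂,ⱼ 10 15 14, path edge 6, spokes u₁v₁,ⱼ 2 7 9 and
-- u₂v₂,ⱼ 3 4 5; the weight is 19 at u₁ and the v₂,ⱼ, and 20 at u₂ and the v₁,ⱼ.
module SmallFirecracker where

  open Firecracker 2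

  vertexLabelIndex : Vec (Fin 15) 8
  vertexLabelIndex = # 0 ∷ # 7 ∷ # 11 ∷ # 12 ∷ # 10 ∷ # 9 ∷ # 14 ∷ # 13 ∷ []

  edgeLabelIndex : Vec (Fin 15) 7
  edgeLabelIndex = # 5 ∷ # 1 ∷ # 6 ∷ # 8 ∷ # 2 ∷ # 3 ∷ # 4 ∷ []

  labelled : Vec Element 15
  labelled = inj₁ (# 0) ∷ inj₂ (# 1) ∷ inj₂ (# 4) ∷ inj₂ (# 5) ∷ inj₂ (# 6) ∷ inj₂ (# 0) ∷ inj₂ (# 2) ∷ inj₁ (# 1)
           ∷ inj₂ (# 3) ∷ inj₁ (# 5) ∷ inj₁ (# 4) ∷ inj₁ (# 2) ∷ inj₁ (# 3) ∷ inj₁ (# 7) ∷ inj₁ (# 6) ∷ []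

  labelIndex : Element → Fin 15
  labelIndex = [ lookup vertexLabelIndex , lookup edgeLabelIndex ]′

  labelled-labelIndex : ∀ x → lookup labelled (labelIndex x) ≡ x
  labelled-labelIndex (inj₁ x) =
    toWitness {a? = Fin.all? λ x → Sum.≡-dec Fin._≟_ Fin._≟_ (lookup labelled (labelIndex (inj₁ x))) (inj₁ x)} tt x
  labelled-labelIndex (inj₂ e) =
    toWitness {a? = Fin.all? λ e → Sum.≡-dec Fin._≟_ Fin._≟_ (lookup labelled (labelIndex (inj₂ e))) (inj₂ e)} tt e

  labeling : TotalLabeling F
  labeling = leftInverse⇒bijection labelIndex (lookup labelled) labelled-labelIndex

  antimagic : IsLocalAntimagicTotal F labeling
  antimagic = toWitness
    {a? = Fin.all? λ e → ¬? (weight F labeling (proj₁ (ends F e)) ℕ.≟ weight F labeling (proj₂ (ends F e)))} tt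

  numColours≡2 : numColours F labeling ≡ 2
  numColours≡2 = refl

mainTheorem5 : ∀ (k : ℕ) → 3 ≤ k →
    Σ ℕ λ c → IsChiLat (firecracker 2 k) c × 2 ≤ c × c ≤ 3
mainTheorem5 1 (s≤s ())
mainTheorem5 2 (s≤s (s≤s ()))
mainTheorem5 3 _ =
  2 , ((labeling , antimagic , numColours≡2) , λ g antimagic′ → numColours≥2 F g (antimagic′ pathEdge))
    , ℕ.≤-refl , s≤s (s≤s z≤n)
  where open SmallFirecracker
        open Firecracker 2
mainTheorem5 (suc (suc (suc (suc r)))) _ =
  3 , ((labeling , antimagic , numColours≡3) , localAntimagic⇒3≤numColours r)
    , s≤s (s≤s z≤n) , ℕ.≤-refl
  where open ThreeColouring (suc r)
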